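{- Let $d$ be an integer. If $d$ is HS-prime partitionable, then $d$ is TE-prime partitionable (both notions as defined in the context below).
   Context: An integer $n$ is called HS-prime partitionable if there is a partition $\{\mathbb{P}_1,\mathbb{P}_2\}$ of the set of all primes less than $n$ into two nonempty disjoint sets such that for all positive integers $n_1,n_2$ with $n_1+n_2=n$ there is some pair $(p_1,p_2)\in\mathbb{P}_1\times\mathbb{P}_2$ with $\gcd(n_1,p_1)>1$ or $\gcd(n_2,p_2)>1$. An integer $d$ is called TE-prime partitionable if there exist positive integers $n_1,n_2$ with $d=\gcd(n_1,n_2)$ such that for every pair of positive integers $d_1,d_2$ with $d_1+d_2=d$, either $\gcd(n_1,d_1)\neq 1$ or $\gcd(n_2,d_2)\neq 1$. -}

module Defs where

open import Data.Nat using (ℕ; _+_; _<_)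
open import Data.Nat.GCD using (gcd)
open import Data.Nat.Primality using (Prime)
open import Data.Bool using (Bool; true; false)
open import Data.Product using (Σ; ∃; _×_; _,_)
open import Data.Sum using (_⊎_)
open import Relation.Binary.PropositionalEquality using (_≡_; _≢_)

-- A partition {P₁, P₂} of the set of primes less than n is encoded by a
-- colouring  c : ℕ → Bool  (only its values on primes p < n matter):
--   P₁ = { p prime, p < n, c p ≡ true },  P₂ = { p prime, p < n, c p ≡ false }.
-- These are disjoint and cover all primes < n automatically.

InP₁ : (n : ℕ) → (ℕ → Bool) → ℕ → Set
InP₁ n c p = Prime p × p < n × c p ≡ true

InP₂ : (n : ℕ) → (ℕ → Bool) → ℕ → Set
InP₂ n c p = Prime p × p < n × c p ≡ false

HSPrimePartitionable : ℕ → Set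
HSPrimePartitionable n =
  Σ (ℕ → Bool) λ c →
    (∃ λ p → InP₁ n c p) ×
    (∃ λ p → InP₂ n c p) ×
    ((n₁ n₂ : ℕ) → 0 < n₁ → 0 < n₂ → n₁ + n₂ ≡ n →
       ∃ λ p₁ → ∃ λ p₂ → InP₁ n c p₁ × InP₂ n c p₂ ×
         (1 < gcd n₁ p₁ ⊎ 1 < gcd n₂ p₂))

TEPrimePartitionable : ℕ → Set
TEPrimePartitionable d =
  ∃ λ n₁ → ∃ λ n₂ → 0 < n₁ × 0 < n₂ × d ≡ gcd n₁ n₂ ×
    ((d₁ d₂ : ℕ) → 0 < d₁ → 0 < d₂ → d₁ + d₂ ≡ d →
       gcd n₁ d₁ ≢ 1 ⊎ gcd n₂ d₂ ≢ 1)

module Submission where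

open import Data.Nat using (ℕ)
open import Defs

-- Let c colour the primes below d into the classes P₁ (true)
-- and P₂ (false) of an HS-prime partition of d, and let radical b be the
-- product of the primes below d of colour b.  Take
--     n₁ = d · radical true,   n₂ = d · radical false.  The two radicals are products of disjoint sets of
-- primes, hence coprime, so gcd n₁ n₂ = d · gcd (radical true) (radical false) = d.
-- If d₁ + d₂ = d, the HS property yields p₁ ∈ P₁ with gcd d₁ p₁ > 1 or
-- p₂ ∈ P₂ with gcd d₂ p₂ > 1; since pᵢ divides nᵢ, gcd d₁ p₁ (resp.
-- gcd d₂ p₂) is a nontrivial common divisor of n₁, d₁ (resp. n₂, d₂).

open import Data.Nat using (_+_; _*_; _<_; z≤n)
open import Data.Nat.Properties using (*-identityʳ; *-mono-≤; <-irrefl; ≤-<-trans)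
open import Data.Nat.Divisibility using (_∣_; ∣-trans; ∣1⇒≡1; n∣m*n)
open import Data.Nat.GCD using (gcd; gcd-greatest; gcd[m,n]∣m; gcd[m,n]∣n; c*gcd[m,n]≡gcd[cm,cn])
open import Data.Nat.Coprimality as Coprimality using (Coprime; coprime-divisor; coprime⇒gcd≡1)
open import Data.Nat.Primality using (Prime; prime?; prime⇒irreducible; ¬prime[1]; productOfPrimes≥1)
open import Data.Nat.ListAction using (product)
open import Data.Nat.ListAction.Properties using (∈⇒∣product)
open import Data.Bool using (Bool; true; false)
open import Data.Bool.Properties using () renaming (_≟_ to _≟ᵇ_)
open import Data.List using (List; filter; upTo)
open import Data.List.Membership.Propositional using (_∈_)
open import Data.List.Membership.Propositional.Properties using (∈-filter⁺; ∈-filter⁻; ∈-upTo⁺)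
open import Data.List.Relation.Unary.All as All using (All; []; _∷_)
open import Data.Product using (_×_; _,_; proj₁; proj₂)
open import Data.Sum using (_⊎_; inj₁; inj₂)
open import Data.Empty using (⊥-elim)
open import Relation.Nullary.Decidable using (_×-dec_)
open import Relation.Binary.PropositionalEquality using (_≡_; _≢_; refl; sym; trans; cong; subst; module ≡-Reasoning)
open ≡-Reasoning

coprime-* : ∀ {m a b} → Coprime m a → Coprime m b → Coprime m (a * b)
coprime-* {m} m⊥a m⊥b (i∣m , i∣ab) =
  m⊥b (i∣m , coprime-divisor (λ (j∣i , j∣a) → m⊥a (∣-trans j∣i i∣m , j∣a)) i∣ab)

coprime-product : ∀ {m ns} → All (Coprime m) ns → Coprime m (product ns)
coprime-product []            (_ , i∣1) = ∣1⇒≡1 i∣1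
coprime-product (m⊥n ∷ m⊥ns)  = coprime-* m⊥n (coprime-product m⊥ns)

coprime-products : ∀ {ms ns} → (∀ {m n} → m ∈ ms → n ∈ ns → Coprime m n) →
                   Coprime (product ms) (product ns)
coprime-products {ms} {ns} pairwise =
  coprime-product {product ms} (All.tabulate product-ms-coprime-to)
  where
  product-ms-coprime-to : ∀ {n} → n ∈ ns → Coprime (product ms) n
  product-ms-coprime-to {n} n∈ns = Coprimality.sym
    (coprime-product {n} (All.tabulate λ m∈ms → Coprimality.sym (pairwise m∈ms n∈ns)))

distinct-primes-coprime : ∀ {p q} → Prime p → Prime q → p ≢ q → Coprime p q
distinct-primes-coprime pp pq p≢q (i∣p , i∣q) with prime⇒irreducible pp i∣p
... | inj₁ i≡1 = i≡1
... | inj₂ refl with prime⇒irreducible pq i∣q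
...   | inj₁ refl = ⊥-elim (¬prime[1] pp)
...   | inj₂ p≡q  = ⊥-elim (p≢q p≡q)

gcd-scaled-coprime : ∀ d {a b} → Coprime a b → gcd (d * a) (d * b) ≡ d
gcd-scaled-coprime d {a} {b} a⊥b = begin
  gcd (d * a) (d * b) ≡⟨ sym (c*gcd[m,n]≡gcd[cm,cn] d a b) ⟩
  d * gcd a b         ≡⟨ cong (d *_) (coprime⇒gcd≡1 a⊥b) ⟩
  d * 1               ≡⟨ *-identityʳ d ⟩
  d                   ∎

shared-factor : ∀ {n m p} → p ∣ n → 1 < gcd m p → gcd n m ≢ 1
shared-factor {n} {m} {p} p∣n 1<g gcd≡1 = <-irrefl (sym g≡1) 1<g
  where
  g∣gcd : gcd m p ∣ gcd n m
  g∣gcd = gcd-greatest (∣-trans (gcd[m,n]∣n m p) p∣n) (gcd[m,n]∣m m p)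
  g≡1 : gcd m p ≡ 1
  g≡1 = ∣1⇒≡1 (subst (gcd m p ∣_) gcd≡1 g∣gcd)

colourClass : (ℕ → Bool) → Bool → ℕ → List ℕ
colourClass c b n = filter (λ p → prime? p ×-dec (c p ≟ᵇ b)) (upTo n)

colourClass⁺ : ∀ {c b n p} → Prime p → p < n → c p ≡ b → p ∈ colourClass c b n
colourClass⁺ {c} {b} pp p<n cp≡b =
  ∈-filter⁺ (λ p → prime? p ×-dec (c p ≟ᵇ b)) (∈-upTo⁺ p<n) (pp , cp≡b)

colourClass⁻ : ∀ {c b n p} → p ∈ colourClass c b n → Prime p × c p ≡ b
colourClass⁻ {c} {b} {n} p∈ =
  proj₂ (∈-filter⁻ (λ p → prime? p ×-dec (c p ≟ᵇ b)) {xs = upTo n} p∈)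

radical : (ℕ → Bool) → Bool → ℕ → ℕ
radical c b n = product (colourClass c b n)

radical-pos : ∀ c b n → 0 < radical c b n
radical-pos c b n =
  productOfPrimes≥1 {colourClass c b n} (All.tabulate (λ p∈ → proj₁ (colourClass⁻ {c} {b} {n} p∈)))

-- Different colour classes consist of different primes, so their radicals are coprime.
radicals-coprime : ∀ c n → Coprime (radical c true n) (radical c false n)
radicals-coprime c n = coprime-products λ p∈ q∈ →
  let (pp , cp≡true) = colourClass⁻ {c} {true} {n} p∈
      (pq , cq≡false) = colourClass⁻ {c} {false} {n} q∈
  in distinct-primes-coprime pp pq λ { refl → true≢false (trans (sym cp≡true) cq≡false) }
  where
  true≢false : true ≢ false
  true≢false ()

∣-scaled-radical : ∀ {c b n p} d → Prime p → p < n → c p ≡ b → p ∣ d * radical c b n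
∣-scaled-radical {c} {b} {n} d pp p<n cp≡b =
  ∣-trans (∈⇒∣product (colourClass⁺ {c} {b} {n} pp p<n cp≡b)) (n∣m*n d)

lemma1 : (d : ℕ) → HSPrimePartitionable d → TEPrimePartitionable d
lemma1 d (c , (q , _ , q<d , _) , _ , separates) =
  d * radical c true d , d * radical c false d ,
  *-mono-≤ 0<d (radical-pos c true d) , *-mono-≤ 0<d (radical-pos c false d) ,
  sym (gcd-scaled-coprime d (radicals-coprime c d)) , blocked
  where
  -- d exceeds the prime q in P₁, so it is positive.
  0<d : 0 < d
  0<d = ≤-<-trans z≤n q<d

  blocked : ∀ d₁ d₂ → 0 < d₁ → 0 < d₂ → d₁ + d₂ ≡ d →
            gcd (d * radical c true d) d₁ ≢ 1 ⊎ gcd (d * radical c false d) d₂ ≢ 1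
  blocked d₁ d₂ 0<d₁ 0<d₂ d₁+d₂≡d with separates d₁ d₂ 0<d₁ 0<d₂ d₁+d₂≡d
  ... | p₁ , _ , (pp₁ , p₁<d , cp₁) , _ , inj₁ 1<g = inj₁ (shared-factor (∣-scaled-radical d pp₁ p₁<d cp₁) 1<g)
  ... | _ , p₂ , _ , (pp₂ , p₂<d , cp₂) , inj₂ 1<g = inj₂ (shared-factor (∣-scaled-radical d pp₂ p₂<d cp₂) 1<g)
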